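{- For $n\ge1$ let $W_n$ be the set of words $w=w_1\cdots w_n$ over $\{\mathbf a,\mathbf b,\mathbf c\}$ with $w_1=\mathbf a$ such that every occurrence of $\mathbf c$ is preceded by at least two occurrences of $\mathbf a$. Define $\phi:W_n\to\Pi_n$ recursively: $\phi(\mathbf a)=\{\{1\}\}$, and for $w\in W_n$ with $\phi(w_1\cdots w_{n-1})=B_1/\cdots/B_m$ in standard form, $\phi(w)$ is obtained by adding $\{n\}$ as a new singleton block if $w_n=\mathbf a$, inserting $n$ into $B_m$ if $w_n=\mathbf b$, and inserting $n$ into $B_1$ if $w_n=\mathbf c$. Let $W_n^{**}$ be the set of $w\in W_n$ such that (1) no $\mathbf a$ occurs between any two occurrences of $\mathbf c$, and (2) any $\mathbf c$ in $w$ that is preceded by at least three $\mathbf a$'s is not immediately followed by $\mathbf b$. Then $\phi$ restricts to a bijection from $W_n^{**}$ onto $\Pi_n(1/24/3)$.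
   Context: $\Pi_n$ is the set of set partitions of $[n]$. The standard form of a set partition is $B_1/\cdots/B_m$ with $\min B_1<\cdots<\min B_m$. The standardization of a set partition of a finite set $S\subset\mathbb{Z}_{>0}$ replaces the $i$-th smallest element of $S$ by $i$. A set partition $\pi$ of $[n]$ contains $\tau\vdash[k]$ if for some $S\subseteq[n]$ the standardization of the restriction of $\pi$ to $S$ is $\tau$; otherwise it avoids $\tau$. $\Pi_n(\tau)$ is the set of partitions of $[n]$ avoiding $\tau$. $1/24/3$ is the partition of $[4]$ with blocks $\{1\},\{2,4\},\{3\}$. -}

module Defs where

open import Data.Nat using (ℕ; zero; suc; _∸_; _≤_; _<_; _+_)
open import Data.Fin using (Fin; toℕ)
open import Data.Vec using (Vec; []; _∷_; lookup)
open import Data.Product using (Σ; ∃; _×_; _,_)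
open import Relation.Binary.PropositionalEquality using (_≡_)
open import Relation.Nullary using (¬_)
open import Function.Bundles using (_⇔_)

data Letter : Set where
  a b c : Letter

isA : Letter → ℕ
isA a = 1
isA b = 0
isA c = 0

aBefore : ∀ {n} → Vec Letter n → ℕ → ℕ
aBefore [] k = 0
aBefore (x ∷ w) zero = 0
aBefore (x ∷ w) (suc k) = isA x + aBefore w k

-- Set partitions of [n], encoded by their standard form: position i (0-based,
-- i.e. element i+1 of [n]) is labelled by k when it lies in block B_{k+1} of
-- the standard form B_1/…/B_m (blocks ordered by increasing minima).
-- A labelling is a standard-form labelling iff every label k > 0 has an
-- earlier position labelled k - 1 (so labels are 0..m-1 and the minima of the
-- blocks increase with the label).
IsSetPartition : ∀ {n} → Vec ℕ n → Set
IsSetPartition {n} π =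
  ∀ (i : Fin n) → 0 < lookup π i →
    ∃ λ (j : Fin n) → (toℕ j < toℕ i) × (suc (lookup π j) ≡ lookup π i)

-- Pattern containment: π (partition of [n]) contains τ (partition of [k]) if
-- for some k-subset S = {s 0 < … < s (k-1)} of [n] the standardization of the
-- restriction of π to S is τ, i.e. two elements of S lie in the same block of
-- π iff the corresponding elements lie in the same block of τ.
Contains : ∀ {n k} → Vec ℕ n → Vec ℕ k → Set
Contains {n} {k} π τ =
  ∃ λ (s : Fin k → Fin n) →
    (∀ (x y : Fin k) → toℕ x < toℕ y → toℕ (s x) < toℕ (s y)) ×
    (∀ (x y : Fin k) → (lookup π (s x) ≡ lookup π (s y)) ⇔ (lookup τ x ≡ lookup τ y))

Avoids : ∀ {n k} → Vec ℕ n → Vec ℕ k → Set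
Avoids π τ = ¬ Contains π τ

pat : Vec ℕ 4
pat = 0 ∷ 1 ∷ 2 ∷ 1 ∷ []

InΠavoid : ∀ {n} → Vec ℕ n → Set
InΠavoid π = IsSetPartition π × Avoids π pat

InW : ∀ {n} → Vec Letter n → Set
InW {n} w =
  (∀ (i : Fin n) → toℕ i ≡ 0 → lookup w i ≡ a) ×
  (∀ (i : Fin n) → lookup w i ≡ c → 2 ≤ aBefore w (toℕ i))

InW** : ∀ {n} → Vec Letter n → Set
InW** {n} w =
  InW w ×
  ((∀ (i j k : Fin n) → toℕ i < toℕ j → toℕ j < toℕ k →
      lookup w i ≡ c → lookup w k ≡ c → ¬ (lookup w j ≡ a)) ×
   (∀ (i j : Fin n) → lookup w i ≡ c → 3 ≤ aBefore w (toℕ i) →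
      toℕ j ≡ suc (toℕ i) → ¬ (lookup w j ≡ b)))

-- φ, computed letter by letter; m = number of blocks created so far.
-- a: new singleton block (label m); b: insert into last block B_m (label m-1);
-- c: insert into first block B_1 (label 0).
φgo : ∀ {n} → ℕ → Vec Letter n → Vec ℕ n
φgo m [] = []
φgo m (a ∷ w) = m ∷ φgo (suc m) w
φgo m (b ∷ w) = (m ∸ 1) ∷ φgo m w
φgo m (c ∷ w) = 0 ∷ φgo m w

φ : ∀ {n} → Vec Letter n → Vec ℕ n
φ = φgo 0

-- Number blocks from 0.  If w has k a's before position i, then φ w has k blocks before i and
-- puts i into the new block k (letter a), the last block k - 1 (letter b) or block 0 (letter c),
-- so φ is inverted by reading each letter off the label and the current block count.  A
-- partition avoiding 1/24/3 never puts an element into a block k with 0 < k < m - 1 (m the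
-- current number of blocks): the first elements of blocks 0, k, m - 1 and that element would
-- form an occurrence.  So it lies in the image of φ, and its preimage lies in W** since a
-- violation of either defining condition also produces an occurrence.  Conversely, a case
-- analysis on the letters at the positions of an occurrence in φ w always ends in an a
-- between two c's, or in a c followed (after further c's only) by a b once three a's are read.
module Submission where

open import Defs
open import Data.Nat using (ℕ; zero; suc; pred; _+_; _∸_; _≤_; _<_; _≮_; z≤n; s≤s; z<s; _≟_)
open import Data.Nat.Properties
open import Data.Fin using (Fin; toℕ; fromℕ<) renaming (zero to fzero; suc to fsuc; _<_ to _<ᶠ_)
open import Data.Fin.Properties using (toℕ-fromℕ<; toℕ-injective; toℕ<n)
open import Data.Fin.Induction using (<-wellFounded)
open import Data.Vec using (Vec; []; _∷_; lookup)
open import Data.Vec.Properties using (tabulate∘lookup; tabulate-cong)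
open import Data.Product using (Σ; ∃; _×_; _,_; proj₁; proj₂)
open import Data.Sum using (_⊎_; inj₁; inj₂)
open import Data.Empty using (⊥; ⊥-elim)
open import Function using (_∘_; case_of_)
open import Function.Bundles using (_⇔_; mk⇔; Equivalence)
open import Induction.WellFounded using (Acc; acc)
open import Relation.Nullary using (yes; no)
open import Relation.Binary.PropositionalEquality
open ≤-Reasoning

pred< : ∀ {m} → 0 < m → pred m < m
pred< = ∸-monoʳ-< z<s

pred<⇒≤ : ∀ {m n} → pred m < n → m ≤ n
pred<⇒≤ {m} pred[m]<n = ≤-trans (m≤n+m∸n m 1) pred[m]<n

≢0∧≢pred∧<⇒3≤ : ∀ {p m} → p ≢ 0 → p ≢ pred m → p < m → 3 ≤ m
≢0∧≢pred∧<⇒3≤ {zero} p≢0 _ _ = ⊥-elim (p≢0 refl)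
≢0∧≢pred∧<⇒3≤ {suc _} {suc zero} _ _ (s≤s ())
≢0∧≢pred∧<⇒3≤ {suc zero} {suc (suc zero)} _ p≢pred _ = ⊥-elim (p≢pred refl)
≢0∧≢pred∧<⇒3≤ {suc (suc _)} {suc (suc zero)} _ _ (s≤s (s≤s ()))
≢0∧≢pred∧<⇒3≤ {suc _} {suc (suc (suc _))} _ _ _ = s≤s (s≤s (s≤s z≤n))

vec-ext : ∀ {A : Set} {n} {u v : Vec A n} → (∀ i → lookup u i ≡ lookup v i) → u ≡ v
vec-ext {u = u} {v} u≗v =
  trans (sym (tabulate∘lookup u)) (trans (tabulate-cong u≗v) (tabulate∘lookup v))

aBefore-zero : ∀ {n} (w : Vec Letter n) → aBefore w 0 ≡ 0
aBefore-zero []      = refl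
aBefore-zero (_ ∷ _) = refl

aBefore-suc : ∀ {n} (w : Vec Letter n) (i : Fin n) {l} → lookup w i ≡ l →
  aBefore w (suc (toℕ i)) ≡ isA l + aBefore w (toℕ i)
aBefore-suc (x ∷ w) fzero    refl = cong (isA x +_) (aBefore-zero w)
aBefore-suc (x ∷ w) (fsuc i) refl = begin-equality
  isA x + aBefore w (suc (toℕ i))                 ≡⟨ cong (isA x +_) (aBefore-suc w i refl) ⟩
  isA x + (isA (lookup w i) + aBefore w (toℕ i))  ≡⟨ +-assoc (isA x) _ _ ⟨
  isA x + isA (lookup w i) + aBefore w (toℕ i)    ≡⟨ cong (_+ aBefore w (toℕ i)) (+-comm (isA x) _) ⟩
  isA (lookup w i) + isA x + aBefore w (toℕ i)    ≡⟨ +-assoc (isA (lookup w i)) _ _ ⟩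
  isA (lookup w i) + (isA x + aBefore w (toℕ i))  ∎

aBefore-mono : ∀ {n} (w : Vec Letter n) {p q} → p ≤ q → aBefore w p ≤ aBefore w q
aBefore-mono []      _                 = z≤n
aBefore-mono (x ∷ w) {zero}            _ = z≤n
aBefore-mono (x ∷ w) {suc _} {suc _} (s≤s p≤q) = +-monoʳ-≤ (isA x) (aBefore-mono w p≤q)

aBefore-cancel-< : ∀ {n} (w : Vec Letter n) {p q} → aBefore w p < aBefore w q → p < q
aBefore-cancel-< w Ap<Aq = ≰⇒> (<⇒≱ Ap<Aq ∘ aBefore-mono w)

kth-a-before : ∀ {n} (w : Vec Letter n) p k → k < aBefore w p →
  Σ (Fin n) λ j → toℕ j < p × lookup w j ≡ a × aBefore w (toℕ j) ≡ k
kth-a-before (a ∷ w) (suc p) zero    _ = fzero , z<s , refl , refl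
kth-a-before (a ∷ w) (suc p) (suc k) (s≤s k<Ap) with kth-a-before w p k k<Ap
... | j , j<p , wⱼ≡a , Aⱼ≡k = fsuc j , s≤s j<p , wⱼ≡a , cong suc Aⱼ≡k
kth-a-before (b ∷ w) (suc p) k k<Ap with kth-a-before w p k k<Ap
... | j , j<p , wⱼ≡a , Aⱼ≡k = fsuc j , s≤s j<p , wⱼ≡a , Aⱼ≡k
kth-a-before (c ∷ w) (suc p) k k<Ap with kth-a-before w p k k<Ap
... | j , j<p , wⱼ≡a , Aⱼ≡k = fsuc j , s≤s j<p , wⱼ≡a , Aⱼ≡k

a-between : ∀ {n} (w : Vec Letter n) p q → aBefore w p < aBefore w q →
  Σ (Fin n) λ j → p ≤ toℕ j × toℕ j < q × lookup w j ≡ a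
a-between w p q Ap<Aq with kth-a-before w q (aBefore w p) Ap<Aq
... | j , j<q , wⱼ≡a , Aⱼ≡Ap = j , ≮⇒≥ j≮p , j<q , wⱼ≡a
  where
  j≮p : toℕ j ≮ p
  j≮p j<p = 1+n≰n (begin
    suc (aBefore w p)           ≡⟨ cong suc Aⱼ≡Ap ⟨
    suc (aBefore w (toℕ j))     ≡⟨ aBefore-suc w j wⱼ≡a ⟨
    aBefore w (suc (toℕ j))     ≤⟨ aBefore-mono w j<p ⟩
    aBefore w p                 ∎)

1≤aBefore : ∀ {n} (w : Vec Letter n) → InW w → (i : Fin n) → 0 < toℕ i → 1 ≤ aBefore w (toℕ i)
1≤aBefore (x ∷ w) (starts-with-a , _) (fsuc i) _ rewrite starts-with-a fzero refl = s≤s z≤n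

label : Letter → ℕ → ℕ
label a k = k
label b k = pred k
label c k = 0

label≤ : ∀ l k → label l k ≤ k
label≤ a k = ≤-refl
label≤ b k = m∸n≤m k 1
label≤ c k = z≤n

lookup-φgo : ∀ {n} m (w : Vec Letter n) (i : Fin n) →
  lookup (φgo m w) i ≡ label (lookup w i) (m + aBefore w (toℕ i))
lookup-φgo m (a ∷ w) fzero    = sym (+-identityʳ m)
lookup-φgo m (b ∷ w) fzero    = cong pred (sym (+-identityʳ m))
lookup-φgo m (c ∷ w) fzero    = refl
lookup-φgo m (a ∷ w) (fsuc i) =
  trans (lookup-φgo (suc m) w i) (cong (label (lookup w i)) (sym (+-suc m _)))
lookup-φgo m (b ∷ w) (fsuc i) = lookup-φgo m w i
lookup-φgo m (c ∷ w) (fsuc i) = lookup-φgo m w i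

lookup-φ : ∀ {n} (w : Vec Letter n) (i : Fin n) {l} → lookup w i ≡ l →
  lookup (φ w) i ≡ label l (aBefore w (toℕ i))
lookup-φ w i refl = lookup-φgo 0 w i

φ-label≤ : ∀ {n} (w : Vec Letter n) (i : Fin n) → lookup (φ w) i ≤ aBefore w (toℕ i)
φ-label≤ w i = subst (_≤ aBefore w (toℕ i)) (sym (lookup-φ w i refl)) (label≤ (lookup w i) _)

φ-isSetPartition : ∀ {n} (w : Vec Letter n) → IsSetPartition (φ w)
φ-isSetPartition w i 0<πᵢ
  with kth-a-before w (toℕ i) (pred (lookup (φ w) i)) (<-≤-trans (pred< 0<πᵢ) (φ-label≤ w i))
... | j , j<i , wⱼ≡a , Aⱼ≡ =
  j , j<i , trans (cong suc (trans (lookup-φ w j wⱼ≡a) Aⱼ≡)) (m+[n∸m]≡n 0<πᵢ)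

φ-label< : ∀ {n} (w : Vec Letter n) → InW w → ∀ i → lookup (φ w) i < aBefore w (suc (toℕ i))
φ-label< w inW i with lookup w i in wᵢ
... | a = subst₂ _<_ (sym (lookup-φ w i wᵢ)) (sym (aBefore-suc w i wᵢ)) (n<1+n _)
... | b = subst₂ _<_ (sym (lookup-φ w i wᵢ)) (sym (aBefore-suc w i wᵢ))
            (pred< (1≤aBefore w inW i 0<i))
  where
  0<i : 0 < toℕ i
  0<i = n≢0⇒n>0 λ i≡0 → case trans (sym wᵢ) (proj₁ inW i i≡0) of λ ()
... | c = subst₂ _<_ (sym (lookup-φ w i wᵢ)) (sym (aBefore-suc w i wᵢ))
            (≤-trans (s≤s z≤n) (proj₂ inW i wᵢ))

record Occurrence {n} (π : Vec ℕ n) : Set where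
  constructor occurrence
  field
    x y z t : Fin n
    x<y : toℕ x < toℕ y
    y<z : toℕ y < toℕ z
    z<t : toℕ z < toℕ t
    πy≡πt : lookup π y ≡ lookup π t
    πx≢πy : lookup π x ≢ lookup π y
    πx≢πz : lookup π x ≢ lookup π z
    πy≢πz : lookup π y ≢ lookup π z

occurrence⇒contains : ∀ {n} {π : Vec ℕ n} → Occurrence π → Contains π pat
occurrence⇒contains {n} {π} (occurrence x y z t x<y y<z z<t πy≡πt πx≢πy πx≢πz πy≢πz) =
  s , s-mono , s-relabels
  where
  s : Fin 4 → Fin n
  s fzero                      = x
  s (fsuc fzero)               = y
  s (fsuc (fsuc fzero))        = z
  s (fsuc (fsuc (fsuc fzero))) = t

  s-mono : ∀ i j → toℕ i < toℕ j → toℕ (s i) < toℕ (s j)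
  s-mono fzero (fsuc fzero)                             _ = x<y
  s-mono fzero (fsuc (fsuc fzero))                      _ = <-trans x<y y<z
  s-mono fzero (fsuc (fsuc (fsuc fzero)))               _ = <-trans x<y (<-trans y<z z<t)
  s-mono (fsuc fzero) (fsuc (fsuc fzero))               _ = y<z
  s-mono (fsuc fzero) (fsuc (fsuc (fsuc fzero)))        _ = <-trans y<z z<t
  s-mono (fsuc (fsuc fzero)) (fsuc (fsuc (fsuc fzero))) _ = z<t
  s-mono fzero fzero ()
  s-mono (fsuc _) fzero ()
  s-mono (fsuc fzero) (fsuc fzero) (s≤s ())
  s-mono (fsuc (fsuc _)) (fsuc fzero) (s≤s ())
  s-mono (fsuc (fsuc fzero)) (fsuc (fsuc fzero)) (s≤s (s≤s ()))
  s-mono (fsuc (fsuc (fsuc _))) (fsuc (fsuc fzero)) (s≤s (s≤s ()))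
  s-mono (fsuc (fsuc (fsuc fzero))) (fsuc (fsuc (fsuc fzero))) (s≤s (s≤s (s≤s ())))

  πx≢πt : lookup π x ≢ lookup π t
  πx≢πt πx≡πt = πx≢πy (trans πx≡πt (sym πy≡πt))
  πz≢πt : lookup π z ≢ lookup π t
  πz≢πt πz≡πt = πy≢πz (trans πy≡πt (sym πz≡πt))

  equal : ∀ {p q k : ℕ} → p ≡ q → (p ≡ q) ⇔ (k ≡ k)
  equal p≡q = mk⇔ (λ _ → refl) (λ _ → p≡q)
  unequal : ∀ {p q k l : ℕ} → p ≢ q → k ≢ l → (p ≡ q) ⇔ (k ≡ l)
  unequal p≢q k≢l = mk⇔ (⊥-elim ∘ p≢q) (⊥-elim ∘ k≢l)

  s-relabels : ∀ i j → (lookup π (s i) ≡ lookup π (s j)) ⇔ (lookup pat i ≡ lookup pat j)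
  s-relabels fzero                      fzero                      = equal refl
  s-relabels fzero                      (fsuc fzero)               = unequal πx≢πy λ ()
  s-relabels fzero                      (fsuc (fsuc fzero))        = unequal πx≢πz λ ()
  s-relabels fzero                      (fsuc (fsuc (fsuc fzero))) = unequal πx≢πt λ ()
  s-relabels (fsuc fzero)               fzero                      = unequal (≢-sym πx≢πy) λ ()
  s-relabels (fsuc fzero)               (fsuc fzero)               = equal refl
  s-relabels (fsuc fzero)               (fsuc (fsuc fzero))        = unequal πy≢πz λ ()
  s-relabels (fsuc fzero)               (fsuc (fsuc (fsuc fzero))) = equal πy≡πt
  s-relabels (fsuc (fsuc fzero))        fzero                      = unequal (≢-sym πx≢πz) λ ()
  s-relabels (fsuc (fsuc fzero))        (fsuc fzero)               = unequal (≢-sym πy≢πz) λ ()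
  s-relabels (fsuc (fsuc fzero))        (fsuc (fsuc fzero))        = equal refl
  s-relabels (fsuc (fsuc fzero))        (fsuc (fsuc (fsuc fzero))) = unequal πz≢πt λ ()
  s-relabels (fsuc (fsuc (fsuc fzero))) fzero                      = unequal (≢-sym πx≢πt) λ ()
  s-relabels (fsuc (fsuc (fsuc fzero))) (fsuc fzero)               = equal (sym πy≡πt)
  s-relabels (fsuc (fsuc (fsuc fzero))) (fsuc (fsuc fzero))        = unequal (≢-sym πz≢πt) λ ()
  s-relabels (fsuc (fsuc (fsuc fzero))) (fsuc (fsuc (fsuc fzero))) = equal refl

contains⇒occurrence : ∀ {n} {π : Vec ℕ n} → Contains π pat → Occurrence π
contains⇒occurrence (s , s-mono , s-relabels) = occurrence
  (s fzero) (s (fsuc fzero)) (s (fsuc (fsuc fzero))) (s (fsuc (fsuc (fsuc fzero))))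
  (s-mono fzero (fsuc fzero) z<s)
  (s-mono (fsuc fzero) (fsuc (fsuc fzero)) (s≤s z<s))
  (s-mono (fsuc (fsuc fzero)) (fsuc (fsuc (fsuc fzero))) (s≤s (s≤s z<s)))
  (from (fsuc fzero) (fsuc (fsuc (fsuc fzero))) refl)
  (λ e → case to fzero (fsuc fzero) e of λ ())
  (λ e → case to fzero (fsuc (fsuc fzero)) e of λ ())
  (λ e → case to (fsuc fzero) (fsuc (fsuc fzero)) e of λ ())
  where
  to   = λ i j → Equivalence.to (s-relabels i j)
  from = λ i j → Equivalence.from (s-relabels i j)

-- φ maps W** into Π(1/24/3)

module Avoidance {n} (w : Vec Letter n) (w** : InW** w) where
  private
    A : Fin n → ℕ
    A i = aBefore w (toℕ i)
    π : Fin n → ℕ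
    π = lookup (φ w)
    inW : InW w
    inW = proj₁ w**
    no-a-between-c : ∀ (i j k : Fin n) → toℕ i < toℕ j → toℕ j < toℕ k →
      lookup w i ≡ c → lookup w k ≡ c → lookup w j ≢ a
    no-a-between-c = proj₁ (proj₂ w**)
    no-b-after-c : ∀ (i j : Fin n) → lookup w i ≡ c → 3 ≤ A i →
      toℕ j ≡ suc (toℕ i) → lookup w j ≢ b
    no-b-after-c = proj₂ (proj₂ w**)

  label<aBefore : ∀ {i j} → toℕ i < toℕ j → π i < A j
  label<aBefore {i} i<j = <-≤-trans (φ-label< w inW i) (aBefore-mono w i<j)

  aBefore-constant-between-c : ∀ {u v t} → toℕ u < toℕ v → toℕ v < toℕ t →
    lookup w u ≡ c → lookup w t ≡ c → A u ≡ A v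
  aBefore-constant-between-c {u} {v} {t} u<v v<t wᵤ≡c wₜ≡c =
    ≤-antisym (aBefore-mono w (<⇒≤ u<v)) (≮⇒≥ (no-a ∘ a-between w (toℕ u) (toℕ v)))
    where
    no-a : (Σ (Fin n) λ j → toℕ u ≤ toℕ j × toℕ j < toℕ v × lookup w j ≡ a) → ⊥
    no-a (j , u≤j , j<v , wⱼ≡a) with m≤n⇒m<n∨m≡n u≤j
    ... | inj₁ u<j = no-a-between-c u j t u<j (<-trans j<v v<t) wᵤ≡c wₜ≡c wⱼ≡a
    ... | inj₂ u≡j = case trans (sym wᵤ≡c) (trans (cong (lookup w) (toℕ-injective u≡j)) wⱼ≡a) of λ ()

  -- Walking right from u, the first letter other than c cannot be a (the count would exceed A v),
  -- so it is a b immediately after a c.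
  no-c-b-gap : ∀ k (u v : Fin n) → toℕ v ≡ k + suc (toℕ u) →
    lookup w u ≡ c → lookup w v ≡ b → A u ≡ A v → 3 ≤ A u → ⊥
  no-c-b-gap zero u v v≡u+1 wᵤ≡c wᵥ≡b _ 3≤Aᵤ = no-b-after-c u v wᵤ≡c 3≤Aᵤ v≡u+1 wᵥ≡b
  no-c-b-gap (suc k) u v v≡ wᵤ≡c wᵥ≡b Aᵤ≡Aᵥ 3≤Aᵤ = at-next (fromℕ< u+1<n) (toℕ-fromℕ< u+1<n)
    where
    u+2≤v : suc (suc (toℕ u)) ≤ toℕ v
    u+2≤v = subst (suc (suc (toℕ u)) ≤_) (sym v≡) (s≤s (m≤n+m (suc (toℕ u)) k))
    u+1<n : suc (toℕ u) < n
    u+1<n = ≤-trans u+2≤v (<⇒≤ (toℕ<n v))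
    at-next : (u′ : Fin n) → toℕ u′ ≡ suc (toℕ u) → ⊥
    at-next u′ u′≡u+1 = letter-at-u′ (lookup w u′) refl
      where
      Aᵤ′≡Aᵤ : A u′ ≡ A u
      Aᵤ′≡Aᵤ = trans (cong (aBefore w) u′≡u+1) (aBefore-suc w u wᵤ≡c)
      u′+1≤v : suc (toℕ u′) ≤ toℕ v
      u′+1≤v = subst (λ p → suc p ≤ toℕ v) (sym u′≡u+1) u+2≤v
      v≡k+u′+1 : toℕ v ≡ k + suc (toℕ u′)
      v≡k+u′+1 = trans v≡ (trans (sym (+-suc k _)) (cong (λ p → k + suc p) (sym u′≡u+1)))
      letter-at-u′ : ∀ l → lookup w u′ ≡ l → ⊥
      letter-at-u′ a wᵤ′≡a = 1+n≰n (begin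
        suc (A u)                 ≡⟨ cong suc Aᵤ′≡Aᵤ ⟨
        suc (A u′)                ≡⟨ aBefore-suc w u′ wᵤ′≡a ⟨
        aBefore w (suc (toℕ u′))  ≤⟨ aBefore-mono w u′+1≤v ⟩
        A v                       ≡⟨ Aᵤ≡Aᵥ ⟨
        A u                       ∎)
      letter-at-u′ b wᵤ′≡b = no-b-after-c u u′ wᵤ≡c 3≤Aᵤ u′≡u+1 wᵤ′≡b
      letter-at-u′ c wᵤ′≡c =
        no-c-b-gap k u′ v v≡k+u′+1 wᵤ′≡c wᵥ≡b (trans Aᵤ′≡Aᵤ Aᵤ≡Aᵥ) (subst (3 ≤_) (sym Aᵤ′≡Aᵤ) 3≤Aᵤ)

  no-c-then-b : ∀ {u v} → toℕ u < toℕ v → lookup w u ≡ c → lookup w v ≡ b →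
    A u ≡ A v → 3 ≤ A u → ⊥
  no-c-then-b {u} {v} u<v = no-c-b-gap (toℕ v ∸ suc (toℕ u)) u v (sym (m∸n+n≡m u<v))

  module _ (o : Occurrence (φ w)) where
    open Occurrence o

    ending-a : lookup w t ≡ a → ⊥
    ending-a wₜ≡a = <⇒≢ (label<aBefore (<-trans y<z z<t)) (trans πy≡πt (lookup-φ w t wₜ≡a))

    ending-b : lookup w t ≡ b → ⊥
    ending-b wₜ≡b = at-z (lookup w z) refl
      where
      πy≡predAt : π y ≡ pred (A t)
      πy≡predAt = trans πy≡πt (lookup-φ w t wₜ≡b)
      Az≡At : A z ≡ A t
      Az≡At = ≤-antisym (aBefore-mono w (<⇒≤ z<t))
                         (pred<⇒≤ (subst (_< A z) πy≡predAt (label<aBefore y<z)))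
      at-z : ∀ l → lookup w z ≡ l → ⊥
      at-z a wz≡a = 1+n≰n (begin
        suc (A z)                ≡⟨ aBefore-suc w z wz≡a ⟨
        aBefore w (suc (toℕ z))  ≤⟨ aBefore-mono w z<t ⟩
        A t                      ≡⟨ Az≡At ⟨
        A z                      ∎)
      at-z b wz≡b = πy≢πz (trans πy≡predAt (trans (cong pred (sym Az≡At)) (sym (lookup-φ w z wz≡b))))
      at-z c wz≡c = no-c-then-b z<t wz≡c wₜ≡b Az≡At
        (≢0∧≢pred∧<⇒3≤ (λ πx≡0 → πx≢πz (trans πx≡0 (sym (lookup-φ w z wz≡c))))
                        (λ πx≡pred → πx≢πy (trans πx≡pred (trans (cong pred Az≡At) (sym πy≡predAt))))
                        (label<aBefore (<-trans x<y y<z)))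

    ending-c : lookup w t ≡ c → ⊥
    ending-c wₜ≡c = at-y (lookup w y) refl
      where
      πy≡0 : π y ≡ 0
      πy≡0 = trans πy≡πt (lookup-φ w t wₜ≡c)
      at-y : ∀ l → lookup w y ≡ l → ⊥
      at-y a wy≡a = <⇒≢ (1≤aBefore w inW y (≤-<-trans z≤n x<y)) (trans (sym πy≡0) (lookup-φ w y wy≡a))
      at-y b wy≡b = πx≢πy (trans (n<1⇒n≡0 (<-≤-trans (label<aBefore x<y) Ay≤1)) (sym πy≡0))
        where
        Ay≤1 : A y ≤ 1
        Ay≤1 = m∸n≡0⇒m≤n (trans (sym (lookup-φ w y wy≡b)) πy≡0)
      at-y c wy≡c = at-z (lookup w z) refl
        where
        at-z : ∀ l → lookup w z ≡ l → ⊥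
        at-z a wz≡a = no-a-between-c y z t y<z z<t wy≡c wₜ≡c wz≡a
        at-z b wz≡b = no-c-then-b y<z wy≡c wz≡b Ay≡Az
          (≢0∧≢pred∧<⇒3≤ (λ πx≡0 → πx≢πy (trans πx≡0 (sym πy≡0)))
                          (λ πx≡pred → πx≢πz (trans πx≡pred
                                              (trans (cong pred Ay≡Az) (sym (lookup-φ w z wz≡b)))))
                          (label<aBefore x<y))
          where
          Ay≡Az : A y ≡ A z
          Ay≡Az = aBefore-constant-between-c y<z z<t wy≡c wₜ≡c
        at-z c wz≡c = πy≢πz (trans πy≡0 (sym (lookup-φ w z wz≡c)))

    no-occurrence : ⊥
    no-occurrence with lookup w t in wₜ
    ... | a = ending-a wₜ
    ... | b = ending-b wₜ
    ... | c = ending-c wₜ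

  φ-avoids : Avoids (φ w) pat
  φ-avoids = no-occurrence ∘ contains⇒occurrence

-- The inverse of φ

-- letterOf x m is the letter that puts the next element into block x while m blocks are open.
oldBlockLetter : ℕ → ℕ → Letter
oldBlockLetter zero (suc (suc _)) = c
oldBlockLetter _    _             = b

letterOf : ℕ → ℕ → Letter
letterOf x m with x ≟ m
... | yes _ = a
... | no  _ = oldBlockLetter x m

nextCount : Letter → ℕ → ℕ
nextCount a m = suc m
nextCount b m = m
nextCount c m = m

φ⁻¹go : ∀ {n} → ℕ → Vec ℕ n → Vec Letter n
φ⁻¹go m []      = []
φ⁻¹go m (x ∷ π) = letterOf x m ∷ φ⁻¹go (nextCount (letterOf x m) m) π

φ⁻¹ : ∀ {n} → Vec ℕ n → Vec Letter n
φ⁻¹ = φ⁻¹go 0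

letterOf-self : ∀ m → letterOf m m ≡ a
letterOf-self m with m ≟ m
... | yes _   = refl
... | no  m≢m = ⊥-elim (m≢m refl)

letterOf-pred : ∀ {m} → 1 ≤ m → letterOf (pred m) m ≡ b
letterOf-pred {suc m} _ with m ≟ suc m
letterOf-pred {suc m}       _ | yes m≡1+m = ⊥-elim (<⇒≢ (n<1+n m) m≡1+m)
letterOf-pred {suc zero}    _ | no  _     = refl
letterOf-pred {suc (suc _)} _ | no  _     = refl

letterOf-zero : ∀ {m} → 2 ≤ m → letterOf 0 m ≡ c
letterOf-zero {suc zero}    (s≤s ())
letterOf-zero {suc (suc m)} _ = refl

letterOf≡a⇒ : ∀ {x m} → letterOf x m ≡ a → x ≡ m
letterOf≡a⇒ {x} {m} _ with x ≟ m
letterOf≡a⇒ _  | yes x≡m = x≡m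
letterOf≡a⇒ {zero}  {suc (suc _)} () | no _
letterOf≡a⇒ {zero}  {zero}        () | no _
letterOf≡a⇒ {zero}  {suc zero}    () | no _
letterOf≡a⇒ {suc _}               () | no _

letterOf≡c⇒2≤ : ∀ {x m} → letterOf x m ≡ c → 2 ≤ m
letterOf≡c⇒2≤ {x} {m} _ with x ≟ m
letterOf≡c⇒2≤ () | yes _
letterOf≡c⇒2≤ {zero}  {suc (suc _)} _  | no _ = s≤s (s≤s z≤n)
letterOf≡c⇒2≤ {zero}  {zero}        () | no _
letterOf≡c⇒2≤ {zero}  {suc zero}    () | no _
letterOf≡c⇒2≤ {suc _}               () | no _

label-oldBlockLetter : ∀ {x m} → x ≢ m → suc x ≡ m ⊎ x ≡ 0 → label (oldBlockLetter x m) m ≡ x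
label-oldBlockLetter {zero}  _   (inj₁ refl) = refl
label-oldBlockLetter {suc x} _   (inj₁ refl) = refl
label-oldBlockLetter {zero} {zero}        0≢0 (inj₂ refl) = ⊥-elim (0≢0 refl)
label-oldBlockLetter {zero} {suc zero}    _   (inj₂ refl) = refl
label-oldBlockLetter {zero} {suc (suc _)} _   (inj₂ refl) = refl

label-letterOf : ∀ x m → x ≡ m ⊎ suc x ≡ m ⊎ x ≡ 0 → label (letterOf x m) m ≡ x
label-letterOf x m shape with x ≟ m | shape
... | yes x≡m | _          = sym x≡m
... | no  x≢m | inj₁ x≡m   = ⊥-elim (x≢m x≡m)
... | no  x≢m | inj₂ shape′ = label-oldBlockLetter x≢m shape′

nextCount-+ : ∀ l m k → nextCount l m + k ≡ m + (isA l + k)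
nextCount-+ a m k = sym (+-suc m k)
nextCount-+ b m k = refl
nextCount-+ c m k = refl

lookup-φ⁻¹go : ∀ {n} m (π : Vec ℕ n) (i : Fin n) →
  lookup (φ⁻¹go m π) i ≡ letterOf (lookup π i) (m + aBefore (φ⁻¹go m π) (toℕ i))
lookup-φ⁻¹go m (x ∷ π) fzero    = cong (letterOf x) (sym (+-identityʳ m))
lookup-φ⁻¹go m (x ∷ π) (fsuc i) =
  trans (lookup-φ⁻¹go (nextCount (letterOf x m) m) π i)
        (cong (letterOf (lookup π i)) (nextCount-+ (letterOf x m) m _))

φ⁻¹go-φgo : ∀ {n} m (w : Vec Letter n) → 1 ≤ m →
  (∀ i → lookup w i ≡ c → 2 ≤ m + aBefore w (toℕ i)) → φ⁻¹go m (φgo m w) ≡ w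
φ⁻¹go-φgo m []      _   _    = refl
φ⁻¹go-φgo m (a ∷ w) _   c-ok rewrite letterOf-self m =
  cong (a ∷_) (φ⁻¹go-φgo (suc m) w (s≤s z≤n) λ i wᵢ≡c → subst (2 ≤_) (+-suc m _) (c-ok (fsuc i) wᵢ≡c))
φ⁻¹go-φgo m (b ∷ w) 1≤m c-ok rewrite letterOf-pred 1≤m =
  cong (b ∷_) (φ⁻¹go-φgo m w 1≤m (c-ok ∘ fsuc))
φ⁻¹go-φgo m (c ∷ w) 1≤m c-ok rewrite letterOf-zero (subst (2 ≤_) (+-identityʳ m) (c-ok fzero refl)) =
  cong (c ∷_) (φ⁻¹go-φgo m w 1≤m (c-ok ∘ fsuc))

φ⁻¹-φ : ∀ {n} {w : Vec Letter n} → InW w → φ⁻¹ (φ w) ≡ w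
φ⁻¹-φ {w = []}    _ = refl
φ⁻¹-φ {w = x ∷ w} (starts-with-a , c-ok) with starts-with-a fzero refl
... | refl = cong (a ∷_) (φ⁻¹go-φgo 1 w (s≤s z≤n) (c-ok ∘ fsuc))

φ-injective : ∀ {n} {w w′ : Vec Letter n} → InW w → InW w′ → φ w ≡ φ w′ → w ≡ w′
φ-injective inW inW′ φw≡φw′ = trans (sym (φ⁻¹-φ inW)) (trans (cong φ⁻¹ φw≡φw′) (φ⁻¹-φ inW′))

-- Partitions avoiding 1/24/3 come from W**

module Decoding {n} (π : Vec ℕ n) (partition : IsSetPartition π) (avoids : Avoids π pat) where
  private
    w : Vec Letter n
    w = φ⁻¹ π
    m : Fin n → ℕ
    m i = aBefore w (toℕ i)
    no-occurrence : Occurrence π → ⊥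
    no-occurrence = avoids ∘ occurrence⇒contains

  letter : ∀ i → lookup w i ≡ letterOf (lookup π i) (m i)
  letter = lookup-φ⁻¹go 0 π

  a⇒label≡count : ∀ {i} → lookup w i ≡ a → lookup π i ≡ m i
  a⇒label≡count {i} wᵢ≡a = letterOf≡a⇒ (trans (sym (letter i)) wᵢ≡a)

  label<aBefore-suc : ∀ j → lookup π j ≤ m j → lookup π j < aBefore w (suc (toℕ j))
  label<aBefore-suc j πⱼ≤mⱼ with m≤n⇒m<n∨m≡n πⱼ≤mⱼ
  ... | inj₁ πⱼ<mⱼ = <-≤-trans πⱼ<mⱼ (aBefore-mono w (n≤1+n _))
  ... | inj₂ πⱼ≡mⱼ = begin-strict
    lookup π j               ≡⟨ πⱼ≡mⱼ ⟩
    m j                      <⟨ n<1+n _ ⟩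
    suc (m j)                ≡⟨ aBefore-suc w j wⱼ≡a ⟨
    aBefore w (suc (toℕ j))  ∎
    where
    wⱼ≡a : lookup w j ≡ a
    wⱼ≡a = trans (letter j) (trans (cong (λ x → letterOf x (m j)) πⱼ≡mⱼ) (letterOf-self (m j)))

  label≤count : ∀ i → lookup π i ≤ m i
  label≤count i = go i (<-wellFounded i)
    where
    go : ∀ i → Acc _<ᶠ_ i → lookup π i ≤ m i
    go i (acc rec) with lookup π i | partition i
    ... | zero  | _          = z≤n
    ... | suc k | has-parent with has-parent z<s
    ...   | j , j<i , πⱼ+1≡ = begin
      suc k                    ≡⟨ πⱼ+1≡ ⟨
      suc (lookup π j)         ≤⟨ label<aBefore-suc j (go j (rec j<i)) ⟩
      aBefore w (suc (toℕ j))  ≤⟨ aBefore-mono w j<i ⟩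
      m i                      ∎

  block-start : ∀ i k → k < m i → Σ (Fin n) λ j → toℕ j < toℕ i × lookup π j ≡ k × m j ≡ k
  block-start i k k<mᵢ with kth-a-before w (toℕ i) k k<mᵢ
  ... | j , j<i , wⱼ≡a , mⱼ≡k = j , j<i , trans (a⇒label≡count wⱼ≡a) mⱼ≡k , mⱼ≡k

  no-inner-label : ∀ i → lookup π i ≢ 0 → suc (lookup π i) < m i → ⊥
  no-inner-label i πᵢ≢0 πᵢ+1<mᵢ
    with block-start i 0 (<-trans z<s πᵢ+1<mᵢ)
       | block-start i (lookup π i) (<-trans (n<1+n _) πᵢ+1<mᵢ)
       | block-start i (pred (m i)) (pred< (<-trans z<s πᵢ+1<mᵢ))
  ... | x , _ , πx≡0 , mx≡0 | y , _ , πy≡πᵢ , my≡πᵢ | z , z<i , πz≡ , mz≡ =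
    no-occurrence (occurrence x y z i x<y y<z z<i πy≡πᵢ
      (λ πx≡πy → πᵢ≢0 (trans (sym πy≡πᵢ) (trans (sym πx≡πy) πx≡0)))
      (λ πx≡πz → n≮0 (subst (lookup π i <_) (trans (sym πz≡) (trans (sym πx≡πz) πx≡0)) πᵢ<pred))
      (λ πy≡πz → <⇒≢ πᵢ<pred (trans (sym πy≡πᵢ) (trans πy≡πz πz≡))))
    where
    πᵢ<pred : lookup π i < pred (m i)
    πᵢ<pred = <⇒≤pred πᵢ+1<mᵢ
    x<y : toℕ x < toℕ y
    x<y = aBefore-cancel-< w (subst₂ _<_ (sym mx≡0) (sym my≡πᵢ) (n≢0⇒n>0 πᵢ≢0))
    y<z : toℕ y < toℕ z
    y<z = aBefore-cancel-< w (subst₂ _<_ (sym my≡πᵢ) (sym mz≡) πᵢ<pred)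

  label-shape : ∀ i → lookup π i ≡ m i ⊎ suc (lookup π i) ≡ m i ⊎ lookup π i ≡ 0
  label-shape i with m≤n⇒m<n∨m≡n (label≤count i)
  ... | inj₂ πᵢ≡mᵢ = inj₁ πᵢ≡mᵢ
  ... | inj₁ πᵢ<mᵢ with m≤n⇒m<n∨m≡n πᵢ<mᵢ
  ...   | inj₂ πᵢ+1≡mᵢ = inj₂ (inj₁ πᵢ+1≡mᵢ)
  ...   | inj₁ πᵢ+1<mᵢ with lookup π i ≟ 0
  ...     | yes πᵢ≡0 = inj₂ (inj₂ πᵢ≡0)
  ...     | no  πᵢ≢0 = ⊥-elim (no-inner-label i πᵢ≢0 πᵢ+1<mᵢ)

  φ-φ⁻¹ : φ w ≡ π
  φ-φ⁻¹ = vec-ext λ i → begin-equality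
    lookup (φ w) i                              ≡⟨ lookup-φ w i (letter i) ⟩
    label (letterOf (lookup π i) (m i)) (m i)   ≡⟨ label-letterOf _ _ (label-shape i) ⟩
    lookup π i                                  ∎

  label-at : ∀ {p l} → lookup w p ≡ l → lookup π p ≡ label l (m p)
  label-at {p} wₚ≡l = trans (cong (λ v → lookup v p) (sym φ-φ⁻¹)) (lookup-φ w p wₚ≡l)

  starts-with-a : ∀ i → toℕ i ≡ 0 → lookup w i ≡ a
  starts-with-a i i≡0 = trans (letter i) (cong₂ letterOf πᵢ≡0 mᵢ≡0)
    where
    mᵢ≡0 : m i ≡ 0
    mᵢ≡0 = trans (cong (aBefore w) i≡0) (aBefore-zero w)
    πᵢ≡0 : lookup π i ≡ 0
    πᵢ≡0 = n≤0⇒n≡0 (subst (lookup π i ≤_) mᵢ≡0 (label≤count i))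

  c-after-two-a : ∀ i → lookup w i ≡ c → 2 ≤ m i
  c-after-two-a i wᵢ≡c = letterOf≡c⇒2≤ {lookup π i} (trans (sym (letter i)) wᵢ≡c)

  -- Otherwise the first element of block 1 starts the occurrence 1, 0, m, 0.
  no-a-between-c : ∀ (i j k : Fin n) → toℕ i < toℕ j → toℕ j < toℕ k →
    lookup w i ≡ c → lookup w k ≡ c → lookup w j ≢ a
  no-a-between-c i j k i<j j<k wᵢ≡c wₖ≡c wⱼ≡a with block-start i 1 (c-after-two-a i wᵢ≡c)
  ... | x , x<i , πx≡1 , _ =
    no-occurrence (occurrence x i j k x<i i<j j<k (trans (label-at wᵢ≡c) (sym (label-at wₖ≡c)))
      (λ πx≡πᵢ → case trans (sym πx≡1) (trans πx≡πᵢ (label-at wᵢ≡c)) of λ ())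
      (λ πx≡πⱼ → <⇒≢ 1<mⱼ (trans (sym πx≡1) (trans πx≡πⱼ (label-at wⱼ≡a))))
      (λ πᵢ≡πⱼ → <⇒≢ (<-trans z<s 1<mⱼ) (trans (sym (label-at wᵢ≡c)) (trans πᵢ≡πⱼ (label-at wⱼ≡a)))))
    where
    1<mⱼ : 1 < m j
    1<mⱼ = ≤-trans (c-after-two-a i wᵢ≡c) (aBefore-mono w (<⇒≤ i<j))

  -- Otherwise the first elements of blocks 1 and m-1 give the occurrence 1, m-1, 0, m-1.
  no-b-after-c : ∀ (i j : Fin n) → lookup w i ≡ c → 3 ≤ m i →
    toℕ j ≡ suc (toℕ i) → lookup w j ≢ b
  no-b-after-c i j wᵢ≡c 3≤mᵢ j≡i+1 wⱼ≡b
    with block-start i 1 (≤-trans (s≤s (s≤s z≤n)) 3≤mᵢ)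
       | block-start i (pred (m i)) (pred< (≤-trans z<s 3≤mᵢ))
  ... | x , _ , πx≡1 , mx≡1 | y , y<i , πy≡ , my≡ =
    no-occurrence (occurrence x y i j x<y y<i i<j πy≡πⱼ
      (λ πx≡πy → <⇒≢ 1<pred (trans (sym πx≡1) (trans πx≡πy πy≡)))
      (λ πx≡πᵢ → case trans (sym πx≡1) (trans πx≡πᵢ (label-at wᵢ≡c)) of λ ())
      (λ πy≡πᵢ → <⇒≢ (<-trans z<s 1<pred) (trans (sym (label-at wᵢ≡c)) (trans (sym πy≡πᵢ) πy≡))))
    where
    1<pred : 1 < pred (m i)
    1<pred = ∸-monoˡ-< 3≤mᵢ (s≤s z≤n)
    x<y : toℕ x < toℕ y
    x<y = aBefore-cancel-< w (subst₂ _<_ (sym mx≡1) (sym my≡) 1<pred)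
    i<j : toℕ i < toℕ j
    i<j = subst (toℕ i <_) (sym j≡i+1) (n<1+n _)
    mⱼ≡mᵢ : m j ≡ m i
    mⱼ≡mᵢ = trans (cong (aBefore w) j≡i+1) (aBefore-suc w i wᵢ≡c)
    πy≡πⱼ : lookup π y ≡ lookup π j
    πy≡πⱼ = trans πy≡ (sym (trans (label-at wⱼ≡b) (cong pred mⱼ≡mᵢ)))

  φ⁻¹-inW** : InW** w
  φ⁻¹-inW** = (starts-with-a , c-after-two-a) , (no-a-between-c , no-b-after-c)

lemma4p3 : (n : ℕ) → 1 ≤ n →
    (∀ (w : Vec Letter n) → InW** w → InΠavoid (φ w)) ×
    ((∀ (w w′ : Vec Letter n) → InW** w → InW** w′ → φ w ≡ φ w′ → w ≡ w′) ×
     (∀ (π : Vec ℕ n) → InΠavoid π → ∃ λ (w : Vec Letter n) → InW** w × φ w ≡ π))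
lemma4p3 n _ =
  (λ w w** → φ-isSetPartition w , Avoidance.φ-avoids w w**) ,
  (λ w w′ w** w′** → φ-injective (proj₁ w**) (proj₁ w′**)) ,
  (λ π (partition , avoids) →
    φ⁻¹ π , Decoding.φ⁻¹-inW** π partition avoids , Decoding.φ-φ⁻¹ π partition avoids)
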